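{- Let $\mathcal{R}$ be the Rado graph with vertex set $V$ and let $\mathcal{H}$ be the hypergraph on $V$ whose edges are the subsets of $V$ inducing a subgraph isomorphic to $\mathcal{R}$. Then $\mathcal{S}(\mathcal{R}) \not\leq \mathrm{FAut}(\mathcal{H})$.
   Context: The Rado graph $\mathcal{R}$ is the unique (up to isomorphism) countable graph such that for all finite disjoint sets of vertices $A, B$ there is a vertex adjacent to every vertex of $A$ and to no vertex of $B$. For $X \subseteq V$, $\sigma_X(\mathcal{R})$ is the graph obtained by complementing adjacencies between $X$ and $V\setminus X$. $\mathcal{S}(\mathcal{R})$ is the group of switching automorphisms: permutations of $V$ that are isomorphisms from $\mathcal{R}$ to $\sigma_X(\mathcal{R})$ for some $X \subseteq V$. $\mathrm{FAut}(\mathcal{H})$ is the set of permutations $g$ of $V$ for which there is a finite $S \subseteq V$ such that for every edge $E$ of $\mathcal{H}$, both $(E\setminus S)g$ and $(E\setminus S)g^{ -1}$ are edges of $\mathcal{H}$ (this is a group). -}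

module Defs where

open import Data.Nat using (ℕ; _≟_)
open import Data.Bool using (Bool; true; false; _xor_; _∧_; not)
open import Data.List using (List)
open import Data.List.Membership.Propositional using (_∈_)
open import Data.List.Membership.DecPropositional _≟_ using (_∈?_)
open import Data.Product using (Σ; ∃; _×_; proj₁)
open import Data.Empty using (⊥)
open import Function.Bundles using (_↔_; Inverse)
open import Relation.Binary.PropositionalEquality using (_≡_)
open import Relation.Nullary using (¬_; does)

-- Vertex set V = ℕ (the Rado graph is countably infinite).
-- A graph on ℕ is given by a Boolean adjacency function.
Graph : Set
Graph = ℕ → ℕ → Bool

IsGraph : Graph → Set
IsGraph adj = (∀ x y → adj x y ≡ adj y x) × (∀ x → adj x x ≡ false)

ExtensionProperty : Graph → Set
ExtensionProperty adj =
  ∀ (A B : List ℕ) → (∀ v → v ∈ A → v ∈ B → ⊥) →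
  ∃ λ z → (∀ a → a ∈ A → adj z a ≡ true) × (∀ b → b ∈ B → adj z b ≡ false)

IsRado : Graph → Set
IsRado adj = IsGraph adj × ExtensionProperty adj

Subset : Set
Subset = ℕ → Bool

-- σ_X(R): complement adjacencies between X and V \ X.
switch : Graph → Subset → Graph
switch adj X x y = adj x y xor (X x xor X y)

Perm : Set
Perm = ℕ ↔ ℕ

IsIsoTo : Graph → Graph → Perm → Set
IsIsoTo adj adj' g = ∀ x y → adj' (Inverse.to g x) (Inverse.to g y) ≡ adj x y

InSwitchGroup : Graph → Perm → Set
InSwitchGroup adj g = Σ Subset λ X → IsIsoTo adj (switch adj X) g

Elem : Subset → Set
Elem E = Σ ℕ λ v → E v ≡ true

IsEdge : Graph → Subset → Set
IsEdge adj E =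
  Σ (ℕ ↔ Elem E) λ f →
    ∀ i j → adj (proj₁ (Inverse.to f i)) (proj₁ (Inverse.to f j)) ≡ adj i j

_∖_ : Subset → List ℕ → Subset
(E ∖ S) v = E v ∧ not (does (v ∈? S))

image : Subset → Perm → Subset
image E g y = E (Inverse.from g y)

imageInv : Subset → Perm → Subset
imageInv E g y = E (Inverse.to g y)

InFAut : Graph → Perm → Set
InFAut adj g =
  Σ (List ℕ) λ S → ∀ E → IsEdge adj E →
    IsEdge adj (image (E ∖ S) g) × IsEdge adj (imageInv (E ∖ S) g)

module Submission where

-- Let X be the set of vertices adjacent to exactly one of 0 and 1.  Switching
-- with respect to X preserves the extension property, because the switched
-- adjacencies of a new vertex z are governed by its adjacencies to 0 and 1,
-- which can be prescribed freely; so back-and-forth gives g : R ≅ σ_X(R), an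
-- element of S(R).  Given a finite S, pick v ∉ S ∪ {0, 1} and let F be the set
-- of non-neighbours of v in σ_X(R) outside {0, 1}, which contains v.  Steering
-- adjacency to 0 and 1 again shows that F induces a copy of R, so F is an edge
-- of H.  But v is isolated in σ_X(R)[F ∖ S], so R[(F ∖ S)g⁻¹] ≅ σ_X(R)[F ∖ S]
-- has an isolated vertex and cannot be a copy of R, whereas g ∈ FAut(H) would
-- make it an edge.

open import Defs
open import Axiom.UniquenessOfIdentityProofs using (module Decidable⇒UIP)
open import Data.Bool using (Bool; true; false; _xor_; _∧_; not; if_then_else_)
import Data.Bool.Properties as Bool
open import Data.Empty using (⊥-elim)
open import Data.List using (List; []; _∷_; _++_; map; filter)
open import Data.List.Membership.Propositional using (_∈_; _∉_)
open import Data.List.Membership.Propositional.Properties using (∈-map⁺; ∈-map⁻; ∈-filter⁺; ∈-filter⁻; ∈-++⁺ˡ; ∈-++⁺ʳ)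
open import Data.List.Properties using (map-∘)
open import Data.List.Relation.Binary.Subset.Propositional using (_⊆_)
open import Data.List.Relation.Binary.Subset.Propositional.Properties using (map⁺)
open import Data.List.Relation.Unary.Any using (here; there; any?)
open import Data.Nat using (ℕ; zero; suc; _≟_; _⊔_; _≤′_; ≤′-refl; ≤′-step)
open import Data.Nat.Properties using (m≤m⊔n; m≤n⊔m; ≤⇒≤′)
open import Data.List.Membership.DecPropositional _≟_ using (_∈?_)
open import Data.Product using (Σ; ∃; _×_; _,_; proj₁; proj₂; swap)
open import Data.Product.Properties using (≡-dec)
open import Function.Base using (id; _∘_)
open import Function.Bundles using (_↔_; Inverse; mk↔ₛ′)
open import Relation.Binary.Definitions using (DecidableEquality)
open import Relation.Binary.PropositionalEquality
  using (_≡_; _≢_; refl; sym; trans; cong; cong₂; subst; module ≡-Reasoning)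
open import Relation.Nullary using (¬_; yes; no; does)
open import Relation.Nullary.Decidable using (dec-true; dec-false)

xor-unswitch : ∀ p x s → ((p xor x) xor s) xor (s xor x) ≡ p
xor-unswitch false false false = refl
xor-unswitch false false true  = refl
xor-unswitch false true  false = refl
xor-unswitch false true  true  = refl
xor-unswitch true  false false = refl
xor-unswitch true  false true  = refl
xor-unswitch true  true  false = refl
xor-unswitch true  true  true  = refl

xor-cancel-common : ∀ a b s → (a xor s) xor (b xor s) ≡ a xor b
xor-cancel-common false false false = refl
xor-cancel-common false false true  = refl
xor-cancel-common false true  false = refl
xor-cancel-common false true  true  = refl
xor-cancel-common true  false false = refl
xor-cancel-common true  false true  = refl
xor-cancel-common true  true  false = refl
xor-cancel-common true  true  true  = refl

xor-cancel-twice : ∀ a x → a xor ((a xor x) xor x) ≡ false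
xor-cancel-twice false false = refl
xor-cancel-twice false true  = refl
xor-cancel-twice true  false = refl
xor-cancel-twice true  true  = refl

true≢false : true ≢ false
true≢false ()

Bool-UIP : {a b : Bool} (e e′ : a ≡ b) → e ≡ e′
Bool-UIP = Decidable⇒UIP.≡-irrelevant Bool._≟_

module _ {A : Set} (_≟ᴬ_ : DecidableEquality A) where

  update : A → Bool → (A → Bool) → A → Bool
  update u b p c = if does (c ≟ᴬ u) then b else p c

  update-≡ : ∀ u b p → update u b p u ≡ b
  update-≡ u b p rewrite dec-true (u ≟ᴬ u) refl = refl

  update-≢ : ∀ {u c} b p → c ≢ u → update u b p c ≡ p c
  update-≢ {u} {c} b p c≢u rewrite dec-false (c ≟ᴬ u) c≢u = refl

IsSimple : {A : Set} → (A → A → Bool) → Set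
IsSimple G = (∀ x y → G x y ≡ G y x) × (∀ x → G x x ≡ false)

PatternProperty : {A : Set} → (A → A → Bool) → Set
PatternProperty {A} G =
  ∀ (L : List A) (p : A → Bool) → ∃ λ z → ∀ c → c ∈ L → G z c ≡ p c

FreshPatternProperty : {A : Set} → (A → A → Bool) → Set
FreshPatternProperty {A} G =
  ∀ (L : List A) (p : A → Bool) → ∃ λ z → z ∉ L × (∀ c → c ∈ L → G z c ≡ p c)

Isomorphic : {A B : Set} → (A → A → Bool) → (B → B → Bool) → Set
Isomorphic {A} {B} GA GB =
  Σ (A ↔ B) λ f → ∀ x y → GB (Inverse.to f x) (Inverse.to f y) ≡ GA x y

induced : Graph → (E : Subset) → Elem E → Elem E → Bool
induced G E a b = G (proj₁ a) (proj₁ b)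

induced-isSimple : {G : Graph} (E : Subset) → IsSimple G → IsSimple (induced G E)
induced-isSimple E (symmetric , loopless) =
  (λ a b → symmetric (proj₁ a) (proj₁ b)) , (λ a → loopless (proj₁ a))

ExtensionProperty⇒PatternProperty : {G : Graph} → ExtensionProperty G → PatternProperty G
ExtensionProperty⇒PatternProperty {G} extension L p = z , realises
  where
  valued : Bool → List ℕ
  valued b = filter (λ c → p c Bool.≟ b) L

  valued-∈ : ∀ {b c} → c ∈ valued b → p c ≡ b
  valued-∈ {b} c∈ = proj₂ (∈-filter⁻ (λ c → p c Bool.≟ b) {xs = L} c∈)

  witness = extension (valued true) (valued false)
    (λ c t f → true≢false (trans (sym (valued-∈ t)) (valued-∈ f)))
  z : ℕ
  z = proj₁ witness

  realises : ∀ c → c ∈ L → G z c ≡ p c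
  realises c c∈L with p c in pc
  ... | true  = proj₁ (proj₂ witness) c (∈-filter⁺ (λ c → p c Bool.≟ true) c∈L pc)
  ... | false = proj₂ (proj₂ witness) c (∈-filter⁺ (λ c → p c Bool.≟ false) c∈L pc)

-- A vertex u adjacent to all of L lies outside L; a vertex realising the pattern
-- on u ∷ L and non-adjacent to u then lies outside L as well.
PatternProperty⇒FreshPatternProperty : {A : Set} {G : A → A → Bool} → DecidableEquality A →
  IsSimple G → PatternProperty G → FreshPatternProperty G
PatternProperty⇒FreshPatternProperty {A} {G} _≟ᴬ_ (symmetric , loopless) realise L p =
  z , z∉L , λ c c∈L → trans (z-realises c (there c∈L)) (update-≢ _≟ᴬ_ false p (u≢ c∈L))
  where
  u : A
  u = proj₁ (realise L (λ _ → true))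
  u-adjacent : ∀ {c} → c ∈ L → G u c ≡ true
  u-adjacent = proj₂ (realise L (λ _ → true)) _

  u≢ : ∀ {c} → c ∈ L → c ≢ u
  u≢ c∈L refl = true≢false (trans (sym (u-adjacent c∈L)) (loopless u))

  witness = realise (u ∷ L) (update _≟ᴬ_ u false p)
  z : A
  z = proj₁ witness
  z-realises : ∀ c → c ∈ u ∷ L → G z c ≡ update _≟ᴬ_ u false p c
  z-realises = proj₂ witness

  z∉L : z ∉ L
  z∉L z∈L = true≢false (begin
    true                    ≡⟨ sym (u-adjacent z∈L) ⟩
    G u z                   ≡⟨ symmetric u z ⟩
    G z u                   ≡⟨ z-realises u (here refl) ⟩
    update _≟ᴬ_ u false p u ≡⟨ update-≡ _≟ᴬ_ u false p ⟩
    false                   ∎)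
    where open ≡-Reasoning

record IsPartialIso {A B : Set} (GA : A → A → Bool) (GB : B → B → Bool)
                    (R : A × B → Set) : Set where
  field
    preserves  : ∀ {p q} → R p → R q → GB (proj₂ p) (proj₂ q) ≡ GA (proj₁ p) (proj₁ q)
    functional : ∀ {p q} → R p → R q → proj₁ p ≡ proj₁ q → proj₂ p ≡ proj₂ q
    injective  : ∀ {p q} → R p → R q → proj₂ p ≡ proj₂ q → proj₁ p ≡ proj₁ q

open IsPartialIso

module _ {A B : Set} {GA : A → A → Bool} {GB : B → B → Bool} where

  IsPartialIso-⊆ : {R R′ : A × B → Set} → (∀ {p} → R′ p → R p) →
    IsPartialIso GA GB R → IsPartialIso GA GB R′
  IsPartialIso-⊆ R′⊆R π = record
    { preserves  = λ r s → preserves π (R′⊆R r) (R′⊆R s)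
    ; functional = λ r s → functional π (R′⊆R r) (R′⊆R s)
    ; injective  = λ r s → injective π (R′⊆R r) (R′⊆R s)
    }

  IsPartialIso-swap : {R : A × B → Set} → IsPartialIso GA GB R → IsPartialIso GB GA (R ∘ swap)
  IsPartialIso-swap π = record
    { preserves  = λ r s → sym (preserves π r s)
    ; functional = injective π
    ; injective  = functional π
    }

  IsPartialIso-[] : IsPartialIso GA GB (_∈ [])
  IsPartialIso-[] = record { preserves = λ () ; functional = λ () ; injective = λ () }

  IsPartialIso-∷ : IsSimple GA → IsSimple GB → {ps : List (A × B)} {a : A} {b : B} →
    IsPartialIso GA GB (_∈ ps) → a ∉ map proj₁ ps → b ∉ map proj₂ ps →
    (∀ {q} → q ∈ ps → GB b (proj₂ q) ≡ GA a (proj₁ q)) →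
    IsPartialIso GA GB (_∈ (a , b) ∷ ps)
  IsPartialIso-∷ (symmetricA , looplessA) (symmetricB , looplessB) {ps} {a} {b} π a∉ b∉ agrees =
    record { preserves = preserves′ ; functional = functional′ ; injective = injective′ }
    where
    preserves′ : ∀ {p q} → p ∈ (a , b) ∷ ps → q ∈ (a , b) ∷ ps →
                 GB (proj₂ p) (proj₂ q) ≡ GA (proj₁ p) (proj₁ q)
    preserves′ (here refl)     (here refl) = trans (looplessB b) (sym (looplessA a))
    preserves′ (here refl)     (there q∈)  = agrees q∈
    preserves′ {p} (there p∈) (here refl)  =
      trans (symmetricB (proj₂ p) b) (trans (agrees p∈) (symmetricA a (proj₁ p)))
    preserves′ (there p∈)      (there q∈)  = preserves π p∈ q∈

    functional′ : ∀ {p q} → p ∈ (a , b) ∷ ps → q ∈ (a , b) ∷ ps → proj₁ p ≡ proj₁ q → proj₂ p ≡ proj₂ q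
    functional′ (here refl) (here refl) _    = refl
    functional′ (here refl) (there q∈)  refl = ⊥-elim (a∉ (∈-map⁺ proj₁ q∈))
    functional′ (there p∈)  (here refl) refl = ⊥-elim (a∉ (∈-map⁺ proj₁ p∈))
    functional′ (there p∈)  (there q∈)  e    = functional π p∈ q∈ e

    injective′ : ∀ {p q} → p ∈ (a , b) ∷ ps → q ∈ (a , b) ∷ ps → proj₂ p ≡ proj₂ q → proj₁ p ≡ proj₁ q
    injective′ (here refl) (here refl) _    = refl
    injective′ (here refl) (there q∈)  refl = ⊥-elim (b∉ (∈-map⁺ proj₂ q∈))
    injective′ (there p∈)  (here refl) refl = ⊥-elim (b∉ (∈-map⁺ proj₂ p∈))
    injective′ (there p∈)  (there q∈)  e    = injective π p∈ q∈ e

  IsPartialIso⇒Isomorphic : {R : A × B → Set} → IsPartialIso GA GB R →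
    (∀ a → ∃ λ b → R (a , b)) → (∀ b → ∃ λ a → R (a , b)) → Isomorphic GA GB
  IsPartialIso⇒Isomorphic π total surjective =
    mk↔ₛ′ to from to∘from from∘to , λ x y → preserves π (proj₂ (total x)) (proj₂ (total y))
    where
    to : A → B
    to a = proj₁ (total a)
    from : B → A
    from b = proj₁ (surjective b)
    to∘from : ∀ b → to (from b) ≡ b
    to∘from b = functional π (proj₂ (total (from b))) (proj₂ (surjective b)) refl
    from∘to : ∀ a → from (to a) ≡ a
    from∘to a = injective π (proj₂ (surjective (to a))) (proj₂ (total a)) refl

module _ {A B : Set} (_≟ᴬ_ : DecidableEquality A) (_≟ᴮ_ : DecidableEquality B)
         {GA : A → A → Bool} {GB : B → B → Bool}
         (simpleA : IsSimple GA) (simpleB : IsSimple GB) (freshB : FreshPatternProperty GB) where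

  adjacencyPattern : A → List (A × B) → B → Bool
  adjacencyPattern a []             = λ _ → false
  adjacencyPattern a ((x , y) ∷ ps) = update _≟ᴮ_ y (GA a x) (adjacencyPattern a ps)

  adjacencyPattern-correct : ∀ a {ps x y} → (x , y) ∈ ps →
    (∀ {q} → q ∈ ps → proj₂ q ≡ y → proj₁ q ≡ x) → adjacencyPattern a ps y ≡ GA a x
  adjacencyPattern-correct a {(x′ , y′) ∷ ps} {x} {y} xy∈ injective-at-y with y ≟ᴮ y′
  ... | yes y≡y′ = cong (GA a) (injective-at-y (here refl) (sym y≡y′))
  adjacencyPattern-correct a (here refl)  _ | no y≢y′ = ⊥-elim (y≢y′ refl)
  adjacencyPattern-correct a (there xy∈) injective-at-y | no _ =
    adjacencyPattern-correct a xy∈ (injective-at-y ∘ there)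

  forth : (a : A) (ps : List (A × B)) → IsPartialIso GA GB (_∈ ps) →
    ∃ λ ps′ → IsPartialIso GA GB (_∈ ps′) × ps ⊆ ps′ × a ∈ map proj₁ ps′
  forth a ps π with any? (a ≟ᴬ_) (map proj₁ ps)
  ... | yes a∈ = ps , π , id , a∈
  ... | no a∉  = (a , z) ∷ ps , IsPartialIso-∷ simpleA simpleB π a∉ z∉ z-agrees , there , here refl
    where
    witness = freshB (map proj₂ ps) (adjacencyPattern a ps)
    z : B
    z = proj₁ witness
    z∉ : z ∉ map proj₂ ps
    z∉ = proj₁ (proj₂ witness)
    z-agrees : ∀ {q} → q ∈ ps → GB z (proj₂ q) ≡ GA a (proj₁ q)
    z-agrees q∈ = trans (proj₂ (proj₂ witness) _ (∈-map⁺ proj₂ q∈))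
      (adjacencyPattern-correct a q∈ (λ q′∈ → injective π q′∈ q∈))

module _ {A B : Set} (_≟ᴬ_ : DecidableEquality A) (_≟ᴮ_ : DecidableEquality B)
         {GA : A → A → Bool} {GB : B → B → Bool}
         (simpleA : IsSimple GA) (simpleB : IsSimple GB)
         (freshA : FreshPatternProperty GA) (freshB : FreshPatternProperty GB) where

  back : (b : B) (ps : List (A × B)) → IsPartialIso GA GB (_∈ ps) →
    ∃ λ ps′ → IsPartialIso GA GB (_∈ ps′) × ps ⊆ ps′ × b ∈ map proj₂ ps′
  back b ps π =
    let ps′ , π′ , ⊆ps′ , b∈ = forth _≟ᴮ_ _≟ᴬ_ simpleB simpleA freshA b (map swap ps)
                                      (IsPartialIso-⊆ swap-∈ (IsPartialIso-swap π))
    in map swap ps′ , IsPartialIso-⊆ swap-∈ (IsPartialIso-swap π′) ,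
       ∈-map⁺ swap ∘ ⊆ps′ ∘ ∈-map⁺ swap , subst (b ∈_) (map-∘ ps′) b∈
    where
    swap-∈ : {C D : Set} {xs : List (C × D)} {p : D × C} → p ∈ map swap xs → swap p ∈ xs
    swap-∈ p∈ with ∈-map⁻ swap p∈
    ... | _ , q∈ , refl = q∈

  forth-and-back : (a : A) (b : B) (ps : List (A × B)) → IsPartialIso GA GB (_∈ ps) →
    ∃ λ ps′ → IsPartialIso GA GB (_∈ ps′) × ps ⊆ ps′ × a ∈ map proj₁ ps′ × b ∈ map proj₂ ps′
  forth-and-back a b ps π =
    let ps₁ , π₁ , ⊆ps₁ , a∈ = forth _≟ᴬ_ _≟ᴮ_ simpleA simpleB freshB a ps π
        ps₂ , π₂ , ⊆ps₂ , b∈ = back b ps₁ π₁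
    in ps₂ , π₂ , ⊆ps₂ ∘ ⊆ps₁ , map⁺ proj₁ ⊆ps₂ a∈ , b∈

  module _ (enumA : ℕ → A) (enumA-surjective : ∀ a → ∃ λ n → enumA n ≡ a)
           (enumB : ℕ → B) (enumB-surjective : ∀ b → ∃ λ n → enumB n ≡ b) where

    Stage : Set
    Stage = Σ (List (A × B)) λ ps → IsPartialIso GA GB (_∈ ps)

    stage : ℕ → Stage
    stage zero    = [] , IsPartialIso-[]
    stage (suc n) =
      let ps , π , _ = forth-and-back (enumA n) (enumB n) (proj₁ (stage n)) (proj₂ (stage n))
      in ps , π

    pairs : ℕ → List (A × B)
    pairs n = proj₁ (stage n)

    step : ∀ n → pairs n ⊆ pairs (suc n) ×
                 enumA n ∈ map proj₁ (pairs (suc n)) × enumB n ∈ map proj₂ (pairs (suc n))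
    step n = proj₂ (proj₂ (forth-and-back (enumA n) (enumB n) (pairs n) (proj₂ (stage n))))

    pairs-mono : ∀ {m n} → m ≤′ n → pairs m ⊆ pairs n
    pairs-mono ≤′-refl            = id
    pairs-mono (≤′-step {n} m≤′n) = proj₁ (step n) ∘ pairs-mono m≤′n

    InLimit : A × B → Set
    InLimit p = ∃ λ n → p ∈ pairs n

    common-stage : ∀ {p q} → InLimit p → InLimit q → ∃ λ n → p ∈ pairs n × q ∈ pairs n
    common-stage (m , p∈) (n , q∈) =
      m ⊔ n , pairs-mono (≤⇒≤′ (m≤m⊔n m n)) p∈ , pairs-mono (≤⇒≤′ (m≤n⊔m m n)) q∈

    limit-isPartialIso : IsPartialIso GA GB InLimit
    limit-isPartialIso = record
      { preserves  = λ p q → let n , p∈ , q∈ = common-stage p q in preserves  (proj₂ (stage n)) p∈ q∈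
      ; functional = λ p q → let n , p∈ , q∈ = common-stage p q in functional (proj₂ (stage n)) p∈ q∈
      ; injective  = λ p q → let n , p∈ , q∈ = common-stage p q in injective  (proj₂ (stage n)) p∈ q∈
      }

    limit-total : ∀ a → ∃ λ b → InLimit (a , b)
    limit-total a with enumA-surjective a
    ... | n , refl with ∈-map⁻ proj₁ (proj₁ (proj₂ (step n)))
    ... | (_ , b) , ab∈ , refl = b , suc n , ab∈

    limit-surjective : ∀ b → ∃ λ a → InLimit (a , b)
    limit-surjective b with enumB-surjective b
    ... | n , refl with ∈-map⁻ proj₂ (proj₂ (proj₂ (step n)))
    ... | (a , _) , ab∈ , refl = a , suc n , ab∈

    back-and-forth : Isomorphic GA GB
    back-and-forth = IsPartialIso⇒Isomorphic limit-isPartialIso limit-total limit-surjective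

Elem-≟ : (E : Subset) → DecidableEquality (Elem E)
Elem-≟ E = ≡-dec _≟_ (λ e e′ → yes (Bool-UIP e e′))

module _ (E : Subset) (e₀ : Elem E) where

  elemOrDefault : (n : ℕ) (b : Bool) → E n ≡ b → Elem E
  elemOrDefault n true  n∈E = n , n∈E
  elemOrDefault n false _   = e₀

  enumerate : ℕ → Elem E
  enumerate n = elemOrDefault n (E n) refl

  enumerate-proj₁ : (e : Elem E) → enumerate (proj₁ e) ≡ e
  enumerate-proj₁ (n , n∈E) = elemOrDefault-∈ (E n) refl
    where
    elemOrDefault-∈ : ∀ b (E-n≡b : E n ≡ b) → elemOrDefault n b E-n≡b ≡ (n , n∈E)
    elemOrDefault-∈ true  E-n≡b = cong (n ,_) (Bool-UIP E-n≡b n∈E)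
    elemOrDefault-∈ false E-n≡b = ⊥-elim (true≢false (trans (sym n∈E) E-n≡b))

∖-⊆ : ∀ E S {w} → (E ∖ S) w ≡ true → E w ≡ true
∖-⊆ E S {w} = Bool.∧-conicalˡ (E w) _

∖-∈ : ∀ {E} S {w} → E w ≡ true → w ∉ S → (E ∖ S) w ≡ true
∖-∈ S {w} w∈E w∉S rewrite w∈E | dec-false (w ∈? S) w∉S = refl

edge-has-neighbour : {G : Graph} {E : Subset} → PatternProperty G → IsEdge G E →
  (e : Elem E) → ∃ λ (e′ : Elem E) → G (proj₁ e′) (proj₁ e) ≡ true
edge-has-neighbour {G} realise (f , f-iso) e = to j , (begin
    G (proj₁ (to j)) (proj₁ e)             ≡⟨ cong (G (proj₁ (to j)) ∘ proj₁) (sym (strictlyInverseˡ e)) ⟩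
    G (proj₁ (to j)) (proj₁ (to (from e))) ≡⟨ f-iso j (from e) ⟩
    G j (from e)                           ≡⟨ proj₂ (realise (from e ∷ []) (λ _ → true)) (from e) (here refl) ⟩
    true                                   ∎)
  where
  open Inverse f
  open ≡-Reasoning
  j : ℕ
  j = proj₁ (realise (from e ∷ []) (λ _ → true))

image-of-isolated-not-edge : {G G′ : Graph} {E : Subset} {v : ℕ} → PatternProperty G →
  (g : Perm) → IsIsoTo G G′ g → E v ≡ true → (∀ w → E w ≡ true → G′ w v ≡ false) →
  ¬ IsEdge G (imageInv E g)
image-of-isolated-not-edge {G} {G′} {E} {v} realise g g-iso v∈E isolated edge =
  true≢false (begin
    true                    ≡⟨ sym adjacent ⟩
    G x (from v)            ≡⟨ sym (g-iso x (from v)) ⟩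
    G′ (to x) (to (from v)) ≡⟨ cong (G′ (to x)) (strictlyInverseˡ v) ⟩
    G′ (to x) v             ≡⟨ isolated (to x) (proj₂ neighbour) ⟩
    false                   ∎)
  where
  open Inverse g
  open ≡-Reasoning
  from-v∈ : imageInv E g (from v) ≡ true
  from-v∈ = subst (λ y → E y ≡ true) (sym (strictlyInverseˡ v)) v∈E
  neighbour : Elem (imageInv E g)
  neighbour = proj₁ (edge-has-neighbour realise edge (from v , from-v∈))
  x : ℕ
  x = proj₁ neighbour
  adjacent : G x (from v) ≡ true
  adjacent = proj₂ (edge-has-neighbour realise edge (from v , from-v∈))

module Switching (G : Graph) (simple : IsSimple G) (realise : PatternProperty G) (u₀ u₁ : ℕ) where

  X : Subset
  X w = G w u₀ xor G w u₁

  switched-isSimple : IsSimple (switch G X)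
  switched-isSimple =
    (λ x y → cong₂ _xor_ (proj₁ simple x y) (Bool.xor-comm (X x) (X y))) ,
    (λ x → cong₂ _xor_ (proj₂ simple x) (Bool.xor-same (X x)))

  -- Prescribing G z c = (p c xor X c) xor s with s = P u₀ xor P u₁ forces X z = s,
  -- and then the switched adjacency of z to c is p c.
  switched-pattern : PatternProperty (switch G X)
  switched-pattern L p = z , z-realises
    where
    P : ℕ → Bool
    P c = p c xor X c
    s : Bool
    s = P u₀ xor P u₁
    witness = realise (u₀ ∷ u₁ ∷ L) (λ c → P c xor s)
    z : ℕ
    z = proj₁ witness
    z-adj : ∀ {c} → c ∈ u₀ ∷ u₁ ∷ L → G z c ≡ P c xor s
    z-adj = proj₂ witness _
    X-z : X z ≡ s
    X-z = trans (cong₂ _xor_ (z-adj (here refl)) (z-adj (there (here refl))))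
                (xor-cancel-common (P u₀) (P u₁) s)
    z-realises : ∀ c → c ∈ L → switch G X z c ≡ p c
    z-realises c c∈L = trans (cong₂ (λ a b → a xor (b xor X c)) (z-adj (there (there c∈L))) X-z)
                             (xor-unswitch (p c) (X c) s)

  fresh : FreshPatternProperty G
  fresh = PatternProperty⇒FreshPatternProperty _≟_ simple realise

  centres : List ℕ
  centres = u₀ ∷ u₁ ∷ []

  module NonNeighbourhood (u₀≢u₁ : u₀ ≢ u₁) (v : ℕ) (v∉centres : v ∉ centres) where

    F : Subset
    F w = not (does (w ∈? centres)) ∧ not (switch G X w v)

    F-∈ : ∀ {w} → w ∉ centres → switch G X w v ≡ false → F w ≡ true
    F-∈ {w} w∉ nonadjacent rewrite dec-false (w ∈? centres) w∉ | nonadjacent = refl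

    F-∉centres : ∀ {w} → F w ≡ true → w ∉ centres
    F-∉centres {w} w∈F w∈ = true≢false (trans (sym w∈F)
      (cong (λ b → not b ∧ not (switch G X w v)) (dec-true (w ∈? centres) w∈)))

    F-nonadjacent : ∀ {w} → F w ≡ true → switch G X w v ≡ false
    F-nonadjacent w∈F = Bool.not-injective {y = false} (Bool.∧-conicalʳ _ _ w∈F)

    v∈F : F v ≡ true
    v∈F = F-∈ v∉centres (proj₂ switched-isSimple v)

    -- A fresh z realising p on L with G z u₀ = false and G z u₁ = p v xor X v has
    -- X z = p v xor X v, which makes z non-adjacent to v after switching.
    F-pattern : PatternProperty (induced G F)
    F-pattern L p = (z , z∈F) , z-realises
      where
      p₀ : ℕ → Bool
      p₀ = p ∘ enumerate F (v , v∈F)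
      t : Bool
      t = p₀ v xor X v
      q₀ q : ℕ → Bool
      q₀ = update _≟_ u₀ false p₀
      q  = update _≟_ u₁ t q₀

      q-away : ∀ {c} → c ∉ centres → q c ≡ p₀ c
      q-away c∉ = trans (update-≢ _≟_ t q₀ (c∉ ∘ there ∘ here)) (update-≢ _≟_ false p₀ (c∉ ∘ here))

      avoided : List ℕ
      avoided = centres ++ v ∷ map proj₁ L
      witness = fresh avoided q
      z : ℕ
      z = proj₁ witness
      z-adj : ∀ {c} → c ∈ avoided → G z c ≡ q c
      z-adj = proj₂ (proj₂ witness) _

      X-z : X z ≡ t
      X-z = cong₂ _xor_
        (trans (z-adj (here refl)) (trans (update-≢ _≟_ t q₀ u₀≢u₁) (update-≡ _≟_ u₀ false p₀)))
        (trans (z-adj (there (here refl))) (update-≡ _≟_ u₁ t q₀))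

      z∈F : F z ≡ true
      z∈F = F-∈ (proj₁ (proj₂ witness) ∘ ∈-++⁺ˡ) (trans
        (cong₂ (λ a b → a xor (b xor X v)) (trans (z-adj (there (there (here refl)))) (q-away v∉centres)) X-z)
        (xor-cancel-twice (p₀ v) (X v)))

      z-realises : ∀ c → c ∈ L → induced G F (z , z∈F) c ≡ p c
      z-realises c c∈L = begin
        G z (proj₁ c)  ≡⟨ z-adj (there (there (there (∈-map⁺ proj₁ c∈L)))) ⟩
        q (proj₁ c)    ≡⟨ q-away (F-∉centres (proj₂ c)) ⟩
        p₀ (proj₁ c)   ≡⟨ cong p (enumerate-proj₁ F (v , v∈F) c) ⟩
        p c            ∎
        where open ≡-Reasoning

    F-isEdge : IsEdge G F
    F-isEdge = back-and-forth _≟_ (Elem-≟ F) simple (induced-isSimple F simple) fresh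
      (PatternProperty⇒FreshPatternProperty (Elem-≟ F) (induced-isSimple F simple) F-pattern)
      id (λ n → n , refl) (enumerate F (v , v∈F)) (λ e → proj₁ e , enumerate-proj₁ F (v , v∈F) e)

  switching-iso-∉-FAut : u₀ ≢ u₁ → (g : Perm) → IsIsoTo G (switch G X) g → ¬ InFAut G g
  switching-iso-∉-FAut u₀≢u₁ g g-iso (S , preserves-edges) =
    image-of-isolated-not-edge {G′ = switch G X} {E = F ∖ S} {v = v} realise g g-iso (∖-∈ {F} S v∈F (v∉ ∘ ∈-++⁺ʳ centres))
      (λ w w∈ → F-nonadjacent (∖-⊆ F S {w} w∈)) (proj₂ (preserves-edges F F-isEdge))
    where
    v : ℕ
    v = proj₁ (fresh (centres ++ S) (λ _ → false))
    v∉ : v ∉ centres ++ S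
    v∉ = proj₁ (proj₂ (fresh (centres ++ S) (λ _ → false)))
    open NonNeighbourhood u₀≢u₁ v (v∉ ∘ ∈-++⁺ˡ)

proposition2p6 : (adj : Graph) → IsRado adj →
    Σ Perm λ g → InSwitchGroup adj g × ¬ InFAut adj g
proposition2p6 adj (simple , extension) =
  g , (X , g-iso) , switching-iso-∉-FAut (λ ()) g g-iso
  where
  realise : PatternProperty adj
  realise = ExtensionProperty⇒PatternProperty extension
  open Switching adj simple realise 0 1
  fresh-switched : FreshPatternProperty (switch adj X)
  fresh-switched = PatternProperty⇒FreshPatternProperty _≟_ switched-isSimple switched-pattern
  ℕ-enumerated : ∀ n → ∃ λ m → m ≡ n
  ℕ-enumerated n = n , refl
  isomorphism : Isomorphic adj (switch adj X)
  isomorphism = back-and-forth _≟_ _≟_ simple switched-isSimple fresh fresh-switched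
                  id ℕ-enumerated id ℕ-enumerated
  g : Perm
  g = proj₁ isomorphism
  g-iso : IsIsoTo adj (switch adj X) g
  g-iso = proj₂ isomorphism
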